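{- Let $g,n\in\mathbb{N}$ with $g>3$ and $2\le n\le g-2$, and let $\mathcal{F}_{g,n}$ be the set of leaves of the tree $\mathcal{T}_{g,n}$. Suppose that (1) every $S\in\mathcal{F}_{g,n}$ satisfies Wilf's inequality, and (2) $\mathcal{A}(S)$ satisfies Wilf's inequality for every $S\in\mathcal{F}_{g,n}$ such that $\{x\in\mathbb{N}\mid \operatorname{F}(S)-\operatorname{m}(S)+1\le x<\operatorname{F}(S)\}\subseteq S$. Then every numerical semigroup in $\mathcal{H}_{g,n}$ satisfies Wilf's inequality.
   Context: $\mathbb{N}=\{0,1,2,\ldots\}$. A numerical semigroup is a submonoid $S$ of $(\mathbb{N},+)$ with $\mathbb{N}\setminus S$ finite. $\operatorname{H}(S)=\mathbb{N}\setminus S$; $\operatorname{g}(S)=|\operatorname{H}(S)|$; $\operatorname{F}(S)=\max\operatorname{H}(S)$; $\operatorname{m}(S)=\min(S\setminus\{0\})$; $\operatorname{n}(S)=|\{s\in S\mid s<\operatorname{F}(S)\}|$; $\operatorname{e}(S)$ is the number of minimal generators of $S$. $S$ satisfies Wilf's inequality if $\operatorname{e}(S)\operatorname{n}(S)\ge\operatorname{F}(S)+1$. Special gaps: $\operatorname{SG}(S)=\{h\in\operatorname{H}(S)\mid 2h\in S \text{ and } h+s\in S \text{ for all } s\in S\setminus\{0\}\}$. $S$ is special if there is no $h\in\operatorname{SG}(S)\setminus\{\operatorname{F}(S)\}$ with $h>\operatorname{m}(S)$. For non special $S$, $\mathcal{A}(S)=(S\cup\{h\})\setminus\{\operatorname{m}(S)\}$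 with $h=\max(\operatorname{SG}(S)\setminus\{\operatorname{F}(S)\})$. $S_{g,n}=\{0\}\cup\{g,\ldots,g+n-2\}\cup\{x\in\mathbb{N}\mid x\ge g+n\}$. $\mathcal{H}_{g,n}$ is the set consisting of $S_{g,n}$ and all non special numerical semigroups $S$ with $\operatorname{g}(S)=g$, $\operatorname{n}(S)=n$. $\mathcal{T}_{g,n}$ is the oriented graph with vertex set $\mathcal{H}_{g,n}$ and edges all pairs $(S,\mathcal{A}(S))$ with $S\in\mathcal{H}_{g,n}$ non special; $S$ is a child of $T$ if $(S,T)$ is an edge, and a leaf is a vertex with no children. -}

module Defs where

open import Data.Nat using (ℕ; zero; suc; _+_; _*_; _∸_; _≤_; _<_; _≤ᵇ_; _<ᵇ_; _≡ᵇ_)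
open import Data.Nat.Properties using (≤⇒≤ᵇ)
open import Data.Bool using (Bool; true; false; _∧_; _∨_; not; if_then_else_; T)
open import Data.Product using (Σ; _×_; _,_)
open import Data.Sum using (_⊎_)
open import Relation.Nullary using (¬_)
open import Relation.Binary.PropositionalEquality using (_≡_; _≢_; refl)

record CofiniteSet : Set where
  field
    mem      : ℕ → Bool
    bound    : ℕ
    cofinite : ∀ x → bound ≤ x → mem x ≡ true
open CofiniteSet public

_∈ₛ_ : ℕ → CofiniteSet → Set
x ∈ₛ S = mem S x ≡ true

-- S is a numerical semigroup (cofiniteness is built into CofiniteSet)
IsNumericalSemigroup : CofiniteSet → Set
IsNumericalSemigroup S =
  (0 ∈ₛ S) × (∀ x y → x ∈ₛ S → y ∈ₛ S → (x + y) ∈ₛ S)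

SameSet : CofiniteSet → CofiniteSet → Set
SameSet S T = ∀ x → mem S x ≡ mem T x

count : (ℕ → Bool) → ℕ → ℕ
count p zero    = 0
count p (suc k) = (if p k then 1 else 0) + count p k

anyBelow : (ℕ → Bool) → ℕ → Bool
anyBelow p zero    = false
anyBelow p (suc k) = p k ∨ anyBelow p k

lastFalseSuc : (ℕ → Bool) → ℕ → ℕ
lastFalseSuc p zero    = 0
lastFalseSuc p (suc k) = if p k then lastFalseSuc p k else suc k

firstTrueFrom : (ℕ → Bool) → ℕ → ℕ → ℕ
firstTrueFrom p i zero    = i
firstTrueFrom p i (suc k) = if p i then i else firstTrueFrom p (suc i) k

-- genus g(S) = |ℕ \ S|   (all gaps lie below the bound)
genus : CofiniteSet → ℕ
genus S = count (λ x → not (mem S x)) (bound S)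

-- conductor = F(S) + 1 (= 0 when S = ℕ, matching F(ℕ) = -1)
conductor : CofiniteSet → ℕ
conductor S = lastFalseSuc (mem S) (bound S)

-- Frobenius number F(S) = max H(S)  (meaningful when H(S) ≠ ∅)
frob : CofiniteSet → ℕ
frob S = conductor S ∸ 1

-- multiplicity m(S) = min (S \ {0})  (bound or 1 lies in S, so search ends)
mult : CofiniteSet → ℕ
mult S = firstTrueFrom (mem S) 1 (bound S)

nS : CofiniteSet → ℕ
nS S = count (mem S) (frob S)

isMinGen : CofiniteSet → ℕ → Bool
isMinGen S x =
  mem S x ∧ not (x ≡ᵇ 0)
    ∧ not (anyBelow (λ y → not (y ≡ᵇ 0) ∧ mem S y ∧ mem S (x ∸ y)) x)

-- embedding dimension e(S) = number of minimal generators
-- (every minimal generator x satisfies x < bound + m(S), since otherwise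
--  x = m(S) + (x - m(S)) with x - m(S) ≥ bound)
embdim : CofiniteSet → ℕ
embdim S = count (isMinGen S) (bound S + mult S)

Wilf : CofiniteSet → Set
Wilf S = conductor S ≤ embdim S * nS S

IsSpecialGap : CofiniteSet → ℕ → Set
IsSpecialGap S h =
  (mem S h ≡ false) × ((h + h) ∈ₛ S)
    × (∀ s → s ∈ₛ S → s ≢ 0 → (h + s) ∈ₛ S)

IsSpecial : CofiniteSet → Set
IsSpecial S = ¬ Σ ℕ (λ h → IsSpecialGap S h × (h ≢ frob S) × (mult S < h))

IsMaxSGnotF : CofiniteSet → ℕ → Set
IsMaxSGnotF S h =
  IsSpecialGap S h × (h ≢ frob S)
    × (∀ h' → IsSpecialGap S h' → h' ≢ frob S → h' ≤ h)

IsA : CofiniteSet → CofiniteSet → Set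
IsA S T = Σ ℕ (λ h → IsMaxSGnotF S h
  × (∀ x → mem T x ≡ ((x ≡ᵇ h) ∨ (mem S x ∧ not (x ≡ᵇ mult S)))))

private
  T⇒≡ : ∀ {b} → T b → b ≡ true
  T⇒≡ {true} _ = refl

Sgn : ℕ → ℕ → CofiniteSet
Sgn g n = record
  { mem = λ x → (g + n ≤ᵇ x) ∨ ((x ≡ᵇ 0) ∨ ((g ≤ᵇ x) ∧ (suc x <ᵇ g + n)))
  ; bound = g + n
  ; cofinite = λ x le → helper (T⇒≡ (≤⇒≤ᵇ le))
  }
  where
  helper : ∀ {b c} → b ≡ true → (b ∨ c) ≡ true
  helper refl = refl

InH : ℕ → ℕ → CofiniteSet → Set
InH g n S = IsNumericalSemigroup S
  × (SameSet S (Sgn g n) ⊎ ((¬ IsSpecial S) × (genus S ≡ g) × (nS S ≡ n)))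

Child : ℕ → ℕ → CofiniteSet → CofiniteSet → Set
Child g n T S = InH g n T × (¬ IsSpecial T) × IsA T S

IsLeaf : ℕ → ℕ → CofiniteSet → Set
IsLeaf g n S = InH g n S × ¬ Σ CofiniteSet (λ T → Child g n T S)

{-# OPTIONS --safe #-}
module Submission where

-- Induction on the multiplicity: a semigroup S of 𝓗_{g,n} failing Wilf's
-- inequality must be a leaf, because Wilf's inequality passes to S from any
-- child T.  Indeed S = A(T) has the conductor and the n of T (the gap h < F
-- enters, m = m(T) leaves) and a larger multiplicity.  If T has a gap y with
-- F − m < y < F, then y ≤ h by maximality of h, so F + 1 ≤ h + m; hence every
-- minimal generator x ≠ m, F + m of T satisfies x ≤ h + m (otherwise x − m is a
-- larger special gap) and stays a minimal generator of S, which moreover gains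
-- h and 2m; so e(T) ≤ e(S).  Otherwise T satisfies the interval condition of
-- hypothesis (2), which no A(U) does, so T is a leaf and (2) applies.

open import Defs
open import Data.Nat using (ℕ; zero; suc; _+_; _*_; _∸_; _≤_; _<_; _≡ᵇ_; z≤n; s≤s; _≟_; _≤?_; _<?_)
open import Data.Nat.Properties
open import Data.Nat.Induction using (<-wellFounded)
open import Data.Bool using (Bool; true; false; _∧_; _∨_; not; if_then_else_)
open import Data.Bool.Properties
  using (∧-conicalˡ; ∧-conicalʳ; ∧-identityʳ; ¬-not; not-injective; T-≡) renaming (_≟_ to _≟ᴮ_)
open import Data.Product using (Σ; _×_; _,_; proj₁; proj₂)
open import Data.Sum using (_⊎_; inj₁; inj₂)
open import Data.Empty using (⊥-elim)
open import Function using (_∘_)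
open import Function.Bundles using (Equivalence)
open import Induction.WellFounded using (module All)
open import Level using (0ℓ)
open import Relation.Nullary using (¬_; yes; no; contradiction)
open import Relation.Nullary.Decidable using (_×-dec_)
open import Relation.Binary.PropositionalEquality
open import Relation.Binary.Definitions using (tri<; tri≈; tri>)
import Relation.Binary.Construct.On as On

true≢false : true ≢ false
true≢false ()

≡ᵇ-refl : ∀ x → (x ≡ᵇ x) ≡ true
≡ᵇ-refl x = Equivalence.to T-≡ (≡⇒≡ᵇ x x refl)

≡ᵇ-true⇒≡ : ∀ x y → (x ≡ᵇ y) ≡ true → x ≡ y
≡ᵇ-true⇒≡ x y e = ≡ᵇ⇒≡ x y (Equivalence.from T-≡ e)

≢⇒≡ᵇ-false : ∀ x y → x ≢ y → (x ≡ᵇ y) ≡ false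
≢⇒≡ᵇ-false x y x≢y = ¬-not (x≢y ∘ ≡ᵇ-true⇒≡ x y)

∧-intro : ∀ {a b} → a ≡ true → b ≡ true → (a ∧ b) ≡ true
∧-intro refl refl = refl

∨-introˡ : ∀ {a b} → a ≡ true → (a ∨ b) ≡ true
∨-introˡ refl = refl

∨-introʳ : ∀ {a b} → b ≡ true → (a ∨ b) ≡ true
∨-introʳ {true}  _ = refl
∨-introʳ {false} e = e

∨-elim : ∀ {a b} → (a ∨ b) ≡ true → a ≡ true ⊎ b ≡ true
∨-elim {true}  _ = inj₁ refl
∨-elim {false} e = inj₂ e

count-cong : ∀ {p q} N → (∀ x → x < N → p x ≡ q x) → count p N ≡ count q N
count-cong zero    _   = refl
count-cong (suc N) p≡q =
  cong₂ _+_ (cong (λ b → if b then 1 else 0) (p≡q N ≤-refl))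
            (count-cong N (λ x x<N → p≡q x (m<n⇒m<1+n x<N)))

count-mono : ∀ {p q} N → (∀ x → p x ≡ true → q x ≡ true) → count p N ≤ count q N
count-mono zero _ = z≤n
count-mono {p} {q} (suc N) p⇒q with p N in pN | q N in qN
... | true  | true  = s≤s (count-mono N p⇒q)
... | true  | false = contradiction (trans (sym (p⇒q N pN)) qN) true≢false
... | false | true  = m≤n⇒m≤1+n (count-mono N p⇒q)
... | false | false = count-mono N p⇒q

count-∨ : ∀ p q N → count (λ x → p x ∨ q x) N ≤ count p N + count q N
count-∨ p q zero = z≤n
count-∨ p q (suc N) with p N | q N
... | true  | true  = s≤s (≤-trans (count-∨ p q N) (+-monoʳ-≤ (count p N) (n≤1+n _)))
... | true  | false = s≤s (count-∨ p q N)
... | false | true  = ≤-trans (s≤s (count-∨ p q N)) (≤-reflexive (sym (+-suc (count p N) (count q N))))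
... | false | false = count-∨ p q N

count-none : ∀ {p} N → (∀ x → x < N → p x ≡ false) → count p N ≡ 0
count-none zero    _ = refl
count-none (suc N) p≡false rewrite p≡false N ≤-refl =
  count-none N (λ x x<N → p≡false x (m<n⇒m<1+n x<N))

count-≡ᵇ≤1 : ∀ a N → count (_≡ᵇ a) N ≤ 1
count-≡ᵇ≤1 a zero = z≤n
count-≡ᵇ≤1 a (suc N) with N ≟ a
... | yes refl rewrite ≡ᵇ-refl N =
  ≤-reflexive (cong suc (count-none N (λ x x<N → ≢⇒≡ᵇ-false x N (<⇒≢ x<N))))
... | no N≢a rewrite ≢⇒≡ᵇ-false N a N≢a = count-≡ᵇ≤1 a N

count-∨-≡ᵇ : ∀ p a N → count (λ x → p x ∨ (x ≡ᵇ a)) N ≤ suc (count p N)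
count-∨-≡ᵇ p a N = begin
  count (λ x → p x ∨ (x ≡ᵇ a)) N  ≤⟨ count-∨ p (_≡ᵇ a) N ⟩
  count p N + count (_≡ᵇ a) N     ≤⟨ +-monoʳ-≤ (count p N) (count-≡ᵇ≤1 a N) ⟩
  count p N + 1                   ≡⟨ +-comm (count p N) 1 ⟩
  suc (count p N)                 ∎
  where open ≤-Reasoning

count-remove : ∀ p b N → p b ≡ true → b < N
  → count p N ≡ suc (count (λ x → p x ∧ not (x ≡ᵇ b)) N)
count-remove p b (suc N) pb b<1+N with N ≟ b
... | yes refl rewrite pb | ≡ᵇ-refl N =
  cong suc (count-cong N (λ x x<N →
    sym (trans (cong (λ c → p x ∧ not c) (≢⇒≡ᵇ-false x N (<⇒≢ x<N))) (∧-identityʳ (p x)))))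
... | no N≢b rewrite ≢⇒≡ᵇ-false N b N≢b | ∧-identityʳ (p N) =
  trans (cong ((if p N then 1 else 0) +_) (count-remove p b N pb (≤∧≢⇒< (≤-pred b<1+N) (≢-sym N≢b))))
        (+-suc _ _)

count-insert : ∀ p a N → p a ≡ false → a < N
  → count (λ x → (x ≡ᵇ a) ∨ p x) N ≡ suc (count p N)
count-insert p a (suc N) pa a<1+N with N ≟ a
... | yes refl rewrite pa | ≡ᵇ-refl N =
  cong suc (count-cong N (λ x x<N → cong (_∨ p x) (≢⇒≡ᵇ-false x N (<⇒≢ x<N))))
... | no N≢a rewrite ≢⇒≡ᵇ-false N a N≢a =
  trans (cong ((if p N then 1 else 0) +_) (count-insert p a N pa (≤∧≢⇒< (≤-pred a<1+N) (≢-sym N≢a))))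
        (+-suc _ _)

count-beyond : ∀ p N k → (∀ x → N ≤ x → p x ≡ false) → count p (k + N) ≡ count p N
count-beyond p N zero    _ = refl
count-beyond p N (suc k) p≡false rewrite p≡false (k + N) (m≤n+m N k) = count-beyond p N k p≡false

anyBelow-intro : ∀ p k y → y < k → p y ≡ true → anyBelow p k ≡ true
anyBelow-intro p (suc k) y y<1+k py with y ≟ k
... | yes refl rewrite py = refl
... | no y≢k = ∨-introʳ (anyBelow-intro p k y (≤∧≢⇒< (≤-pred y<1+k) y≢k) py)

anyBelow-elim : ∀ p k → anyBelow p k ≡ true → Σ ℕ (λ y → y < k × p y ≡ true)
anyBelow-elim p (suc k) e with ∨-elim {p k} e
... | inj₁ pk = k , ≤-refl , pk
... | inj₂ r with anyBelow-elim p k r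
... | y , y<k , py = y , m<n⇒m<1+n y<k , py

Decomposable : CofiniteSet → ℕ → Set
Decomposable S x = Σ ℕ λ y → 1 ≤ y × y < x × y ∈ₛ S × (x ∸ y) ∈ₛ S

private
  ≢0-true⇒≥1 : ∀ x → not (x ≡ᵇ 0) ≡ true → 1 ≤ x
  ≢0-true⇒≥1 (suc x) _ = s≤s z≤n

  ≥1⇒≢0-true : ∀ x → 1 ≤ x → not (x ≡ᵇ 0) ≡ true
  ≥1⇒≢0-true (suc x) _ = refl

isMinGen-sound : ∀ S x → isMinGen S x ≡ true → x ∈ₛ S × 1 ≤ x × ¬ Decomposable S x
isMinGen-sound S x e =
  ∧-conicalˡ (mem S x) _ e , ≢0-true⇒≥1 x (∧-conicalˡ (not (x ≡ᵇ 0)) _ rest) , indecomposable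
  where
  rest : (not (x ≡ᵇ 0) ∧ not (anyBelow (λ y → not (y ≡ᵇ 0) ∧ mem S y ∧ mem S (x ∸ y)) x)) ≡ true
  rest = ∧-conicalʳ (mem S x) _ e
  indecomposable : ¬ Decomposable S x
  indecomposable (y , y≥1 , y<x , y∈S , x∸y∈S) =
    true≢false (trans (sym (anyBelow-intro _ x y y<x (∧-intro (≥1⇒≢0-true y y≥1) (∧-intro y∈S x∸y∈S))))
                      (not-injective (∧-conicalʳ (not (x ≡ᵇ 0)) _ rest)))

isMinGen-complete : ∀ S x → x ∈ₛ S → 1 ≤ x → ¬ Decomposable S x → isMinGen S x ≡ true
isMinGen-complete S x x∈S x≥1 indecomposable =
  ∧-intro x∈S (∧-intro (≥1⇒≢0-true x x≥1) (cong not (¬-not noSplitting)))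
  where
  noSplitting : anyBelow (λ y → not (y ≡ᵇ 0) ∧ mem S y ∧ mem S (x ∸ y)) x ≢ true
  noSplitting e with anyBelow-elim _ x e
  ... | y , y<x , py = indecomposable
    (y , ≢0-true⇒≥1 y (∧-conicalˡ (not (y ≡ᵇ 0)) _ py) , y<x ,
     ∧-conicalˡ (mem S y) _ summands , ∧-conicalʳ (mem S y) _ summands)
    where
    summands : (mem S y ∧ mem S (x ∸ y)) ≡ true
    summands = ∧-conicalʳ (not (y ≡ᵇ 0)) _ py

lastFalseSuc≤⇒true : ∀ p K x → lastFalseSuc p K ≤ x → x < K → p x ≡ true
lastFalseSuc≤⇒true p (suc K) x le x<1+K with p K in pK
... | false = contradiction le (<⇒≱ x<1+K)
... | true with x ≟ K
...   | yes refl = pK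
...   | no x≢K   = lastFalseSuc≤⇒true p K x le (≤∧≢⇒< (≤-pred x<1+K) x≢K)

lastFalseSuc≡suc⇒false : ∀ p K j → lastFalseSuc p K ≡ suc j → p j ≡ false
lastFalseSuc≡suc⇒false p (suc K) j e with p K in pK
... | true  = lastFalseSuc≡suc⇒false p K j e
... | false rewrite suc-injective e = pK

conductor≤⇒∈ : ∀ S x → conductor S ≤ x → x ∈ₛ S
conductor≤⇒∈ S x c≤x with x <? bound S
... | yes x<b = lastFalseSuc≤⇒true (mem S) (bound S) x c≤x x<b
... | no  x≮b = cofinite S x (≮⇒≥ x≮b)

conductor≡suc⇒∉ : ∀ S j → conductor S ≡ suc j → mem S j ≡ false
conductor≡suc⇒∉ S = lastFalseSuc≡suc⇒false (mem S) (bound S)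

∉⇒<conductor : ∀ S x → mem S x ≡ false → x < conductor S
∉⇒<conductor S x x∉S with x <? conductor S
... | yes x<c = x<c
... | no  x≮c = contradiction (trans (sym (conductor≤⇒∈ S x (≮⇒≥ x≮c))) x∉S) true≢false

conductor-unique : ∀ S j → (∀ x → suc j ≤ x → x ∈ₛ S) → mem S j ≡ false → conductor S ≡ suc j
conductor-unique S j above j∉S with <-cmp (conductor S) (suc j)
... | tri< c<1+j _ _ = contradiction (trans (sym (conductor≤⇒∈ S j (≤-pred c<1+j))) j∉S) true≢false
... | tri≈ _ c≡1+j _ = c≡1+j
... | tri> _ _ c>1+j with conductor S in c≡
...   | suc k = contradiction (trans (sym (above k (≤-pred c>1+j))) (conductor≡suc⇒∉ S k c≡)) true≢false

firstTrueFrom-≥ : ∀ p i k → i ≤ firstTrueFrom p i k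
firstTrueFrom-≥ p i zero = ≤-refl
firstTrueFrom-≥ p i (suc k) with p i
... | true  = ≤-refl
... | false = <⇒≤ (firstTrueFrom-≥ p (suc i) k)

firstTrueFrom-minimal : ∀ p i k j → i ≤ j → j < firstTrueFrom p i k → p j ≡ false
firstTrueFrom-minimal p i zero j i≤j j<i = contradiction i≤j (<⇒≱ j<i)
firstTrueFrom-minimal p i (suc k) j i≤j j<ft with p i in pi
... | true  = contradiction i≤j (<⇒≱ j<ft)
... | false with i ≟ j
...   | yes refl = pi
...   | no i≢j   = firstTrueFrom-minimal p (suc i) k j (≤∧≢⇒< i≤j i≢j) j<ft

firstTrueFrom-found : ∀ p i k → p (firstTrueFrom p i k) ≡ true ⊎ firstTrueFrom p i k ≡ i + k
firstTrueFrom-found p i zero = inj₂ (sym (+-identityʳ i))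
firstTrueFrom-found p i (suc k) with p i in pi
... | true  = inj₁ pi
... | false with firstTrueFrom-found p (suc i) k
...   | inj₁ found = inj₁ found
...   | inj₂ ft≡   = inj₂ (trans ft≡ (sym (+-suc i k)))

mult≥1 : ∀ S → 1 ≤ mult S
mult≥1 S = firstTrueFrom-≥ (mem S) 1 (bound S)

mult∈ : ∀ S → mult S ∈ₛ S
mult∈ S with firstTrueFrom-found (mem S) 1 (bound S)
... | inj₁ found = found
... | inj₂ m≡1+b = subst (_∈ₛ S) (sym m≡1+b) (cofinite S (suc (bound S)) (n≤1+n _))

mult-minimal : ∀ S x → 1 ≤ x → x ∈ₛ S → mult S ≤ x
mult-minimal S x x≥1 x∈S with mult S ≤? x
... | yes m≤x = m≤x
... | no  m≰x = contradiction
  (trans (sym x∈S) (firstTrueFrom-minimal (mem S) 1 (bound S) x x≥1 (≰⇒> m≰x))) true≢false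

-- 1 ≤ bound S excludes S = ℕ with bound 0, whose generator 1 is bound S + mult S.
isMinGen-beyond : ∀ S → 1 ≤ bound S → ∀ x → bound S + mult S ≤ x → isMinGen S x ≡ false
isMinGen-beyond S b≥1 x b+m≤x = ¬-not λ x-gen →
  proj₂ (proj₂ (isMinGen-sound S x x-gen))
    (mult S , mult≥1 S , m<x , mult∈ S , cofinite S (x ∸ mult S) b≤x∸m)
  where
  m<x : mult S < x
  m<x = ≤-trans (+-monoˡ-≤ (mult S) b≥1) b+m≤x
  b≤x∸m : bound S ≤ x ∸ mult S
  b≤x∸m = subst (_≤ x ∸ mult S) (m+n∸n≡m (bound S) (mult S)) (∸-monoˡ-≤ (mult S) b+m≤x)

embdim-padded : ∀ S → 1 ≤ bound S → ∀ k → count (isMinGen S) (k + (bound S + mult S)) ≡ embdim S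
embdim-padded S b≥1 k = count-beyond (isMinGen S) (bound S + mult S) k (isMinGen-beyond S b≥1)

isMinGen⇒< : ∀ S → 1 ≤ bound S → ∀ x → isMinGen S x ≡ true → x < bound S + mult S
isMinGen⇒< S b≥1 x x-gen with x <? bound S + mult S
... | yes x<b+m = x<b+m
... | no  x≮b+m = contradiction (trans (sym x-gen) (isMinGen-beyond S b≥1 x (≮⇒≥ x≮b+m))) true≢false

∉⇒bound≥1 : ∀ S x → mem S x ≡ false → 1 ≤ bound S
∉⇒bound≥1 S x x∉S with bound S in b≡
... | suc _ = s≤s z≤n
... | zero  = contradiction (trans (sym (cofinite S x (subst (_≤ x) (sym b≡) z≤n))) x∉S) true≢false

large-gap-special : ∀ S z → mem S z ≡ false → mult S ≤ z → conductor S ≤ z + mult S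
  → IsSpecialGap S z
large-gap-special S z z∉S m≤z c≤z+m =
  z∉S ,
  conductor≤⇒∈ S (z + z) (≤-trans c≤z+m (+-monoʳ-≤ z m≤z)) ,
  λ s s∈S s≢0 → conductor≤⇒∈ S (z + s)
    (≤-trans c≤z+m (+-monoʳ-≤ z (mult-minimal S s (n≢0⇒n>0 s≢0) s∈S)))

Wilf-transfer : ∀ S T → conductor S ≡ conductor T → nS S ≡ nS T → embdim T ≤ embdim S
  → Wilf T → Wilf S
Wilf-transfer S T c≡ n≡ e≤ wilf = begin
  conductor S          ≡⟨ c≡ ⟩
  conductor T          ≤⟨ wilf ⟩
  embdim T * nS T      ≤⟨ *-monoˡ-≤ (nS T) e≤ ⟩
  embdim S * nS T      ≡⟨ cong (embdim S *_) (sym n≡) ⟩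
  embdim S * nS S      ∎
  where open ≤-Reasoning

module A-map {T S : CofiniteSet} (T-nsg : IsNumericalSemigroup T) (T-nonspecial : ¬ IsSpecial T)
             (S≡A : IsA T S) where

  h m F : ℕ
  h = proj₁ S≡A
  m = mult T
  F = frob T

  h-max : IsMaxSGnotF T h
  h-max = proj₁ (proj₂ S≡A)

  mem-S : ∀ x → mem S x ≡ ((x ≡ᵇ h) ∨ (mem T x ∧ not (x ≡ᵇ m)))
  mem-S = proj₂ (proj₂ S≡A)

  h-special : IsSpecialGap T h
  h-special = proj₁ h-max

  h∉T : mem T h ≡ false
  h∉T = proj₁ h-special

  conductor≡1+F : conductor T ≡ suc F
  conductor≡1+F with conductor T | ∉⇒<conductor T h h∉T
  ... | suc _ | _ = refl

  h<F : h < F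
  h<F = ≤∧≢⇒< (≤-pred (subst (h <_) conductor≡1+F (∉⇒<conductor T h h∉T))) (proj₁ (proj₂ h-max))

  F∉T : mem T F ≡ false
  F∉T = conductor≡suc⇒∉ T F conductor≡1+F

  -- T being non special gives a special gap h′ ≠ F above m, and h is the largest one.
  m<h : m < h
  m<h with m <? h
  ... | yes m<h = m<h
  ... | no  m≮h = ⊥-elim (T-nonspecial λ (h′ , h′-special , h′≢F , m<h′) →
    m≮h (<-≤-trans m<h′ (proj₂ (proj₂ h-max) h′ h′-special h′≢F)))

  m<F : m < F
  m<F = <-trans m<h h<F

  m∈T : m ∈ₛ T
  m∈T = mult∈ T

  +-closed : ∀ x y → x ∈ₛ T → y ∈ₛ T → (x + y) ∈ₛ T
  +-closed = proj₂ T-nsg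

  ∈T⇒≢h : ∀ x → x ∈ₛ T → x ≢ h
  ∈T⇒≢h x x∈T refl = true≢false (trans (sym x∈T) h∉T)

  mem-S≡mem-T : ∀ x → x ≢ h → x ≢ m → mem S x ≡ mem T x
  mem-S≡mem-T x x≢h x≢m rewrite mem-S x | ≢⇒≡ᵇ-false x h x≢h | ≢⇒≡ᵇ-false x m x≢m =
    ∧-identityʳ (mem T x)

  h∈S : h ∈ₛ S
  h∈S rewrite mem-S h | ≡ᵇ-refl h = refl

  ∈S⇒≡h⊎∈T : ∀ x → x ∈ₛ S → x ≡ h ⊎ (x ∈ₛ T × x ≢ m)
  ∈S⇒≡h⊎∈T x x∈S with ∨-elim {x ≡ᵇ h} (trans (sym (mem-S x)) x∈S)
  ... | inj₁ x≡ᵇh = inj₁ (≡ᵇ-true⇒≡ x h x≡ᵇh)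
  ... | inj₂ kept = inj₂ (∧-conicalˡ (mem T x) _ kept ,
                          λ { refl → true≢false (trans (sym (≡ᵇ-refl x))
                                       (not-injective (∧-conicalʳ (mem T x) _ kept))) })

  ∈S⇒∈T : ∀ x → x ∈ₛ S → x ≢ h → x ∈ₛ T
  ∈S⇒∈T x x∈S x≢h with ∈S⇒≡h⊎∈T x x∈S
  ... | inj₁ x≡h        = contradiction x≡h x≢h
  ... | inj₂ (x∈T , _) = x∈T

  ∈S⇒>m : ∀ z → 1 ≤ z → z ∈ₛ S → m < z
  ∈S⇒>m z z≥1 z∈S with ∈S⇒≡h⊎∈T z z∈S
  ... | inj₁ refl           = m<h
  ... | inj₂ (z∈T , z≢m) = ≤∧≢⇒< (mult-minimal T z z≥1 z∈T) (≢-sym z≢m)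

  ∈S⇒+m∈T : ∀ z → z ∈ₛ S → (z + m) ∈ₛ T
  ∈S⇒+m∈T z z∈S with ∈S⇒≡h⊎∈T z z∈S
  ... | inj₁ refl        = proj₂ (proj₂ h-special) m m∈T (≢-sym (<⇒≢ (mult≥1 T)))
  ... | inj₂ (z∈T , _) = +-closed z m z∈T m∈T

  F∉S : mem S F ≡ false
  F∉S = trans (mem-S≡mem-T F (≢-sym (<⇒≢ h<F)) (≢-sym (<⇒≢ m<F))) F∉T

  conductor-A : conductor S ≡ conductor T
  conductor-A = trans (conductor-unique S F above F∉S) (sym conductor≡1+F)
    where
    above : ∀ x → suc F ≤ x → x ∈ₛ S
    above x F<x = trans (mem-S≡mem-T x (≢-sym (<⇒≢ (<-trans h<F F<x))) (≢-sym (<⇒≢ (<-trans m<F F<x))))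
                        (conductor≤⇒∈ T x (subst (_≤ x) (sym conductor≡1+F) F<x))

  frob-A : frob S ≡ F
  frob-A = cong (_∸ 1) conductor-A

  mult-A : m < mult S
  mult-A = ∈S⇒>m (mult S) (mult≥1 S) (mult∈ S)

  nS-A : nS S ≡ nS T
  nS-A = begin
    count (mem S) (frob S)                                ≡⟨ cong (count (mem S)) frob-A ⟩
    count (mem S) F                                       ≡⟨ count-cong F (λ x _ → mem-S x) ⟩
    count (λ x → (x ≡ᵇ h) ∨ (mem T x ∧ not (x ≡ᵇ m))) F ≡⟨ count-insert _ h F h-not-kept h<F ⟩
    suc (count (λ x → mem T x ∧ not (x ≡ᵇ m)) F)         ≡⟨ count-remove (mem T) m F m∈T m<F ⟨
    count (mem T) F                                       ∎
    where
    open ≡-Reasoning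
    h-not-kept : (mem T h ∧ not (h ≡ᵇ m)) ≡ false
    h-not-kept = cong (_∧ not (h ≡ᵇ m)) h∉T

  bound-T≥1 : 1 ≤ bound T
  bound-T≥1 = ∉⇒bound≥1 T h h∉T

  bound-S≥1 : 1 ≤ bound S
  bound-S≥1 = ∉⇒bound≥1 S F F∉S

  h≥1 : 1 ≤ h
  h≥1 = ≤-trans (mult≥1 T) (<⇒≤ m<h)

  h-minGen : isMinGen S h ≡ true
  h-minGen = isMinGen-complete S h h∈S h≥1 λ (y , y≥1 , y<h , y∈S , h∸y∈S) →
    true≢false (trans (sym (subst (_∈ₛ T) (m+[n∸m]≡n (<⇒≤ y<h))
      (+-closed y (h ∸ y) (∈S⇒∈T y y∈S (<⇒≢ y<h))
                          (∈S⇒∈T (h ∸ y) h∸y∈S (<⇒≢ (∸-monoʳ-< {o = 0} y≥1 (<⇒≤ y<h)))))))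
      h∉T)

  m+m∈T : (m + m) ∈ₛ T
  m+m∈T = +-closed m m m∈T m∈T

  m+m-decomposable : Decomposable T (m + m)
  m+m-decomposable = m , mult≥1 T , m<m+n m (mult≥1 T) , m∈T , subst (_∈ₛ T) (sym (m+n∸n≡m m m)) m∈T

  m+m-minGen : isMinGen S (m + m) ≡ true
  m+m-minGen = isMinGen-complete S (m + m) m+m∈S (≤-trans (mult≥1 T) (m≤m+n m m))
    λ (y , y≥1 , y<m+m , y∈S , m+m∸y∈S) →
      <-irrefl refl (subst (m + m <_) (m+[n∸m]≡n (<⇒≤ y<m+m))
        (+-mono-< (∈S⇒>m y y≥1 y∈S) (∈S⇒>m (m + m ∸ y) (m<n⇒0<n∸m y<m+m) m+m∸y∈S)))
    where
    m+m∈S : (m + m) ∈ₛ S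
    m+m∈S = trans (mem-S≡mem-T (m + m) (∈T⇒≢h (m + m) m+m∈T) (≢-sym (<⇒≢ (m<m+n m (mult≥1 T)))))
                  m+m∈T

  module _ {y : ℕ} (y∉T : mem T y ≡ false) (y<F : y < F) (F<y+m : suc F ≤ y + m) where

    y≤h : y ≤ h
    y≤h with m ≤? y
    ... | no  m≰y = <⇒≤ (<-trans (≰⇒> m≰y) m<h)
    ... | yes m≤y = proj₂ (proj₂ h-max) y
      (large-gap-special T y y∉T m≤y (subst (_≤ y + m) (sym conductor≡1+F) F<y+m)) (<⇒≢ y<F)

    conductor≤h+m : conductor T ≤ h + m
    conductor≤h+m = subst (_≤ h + m) (sym conductor≡1+F) (≤-trans F<y+m (+-monoˡ-≤ m y≤h))

    -- Otherwise x − m would be a special gap above h other than F.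
    minGen≤h+m : ∀ x → isMinGen T x ≡ true → x ≢ F + m → x ≤ h + m
    minGen≤h+m x x-gen x≢F+m with x ≤? h + m
    ... | yes x≤h+m = x≤h+m
    ... | no  x≰h+m = contradiction (proj₂ (proj₂ h-max) z z-special z≢F) (<⇒≱ h<z)
      where
      h+m<x : h + m < x
      h+m<x = ≰⇒> x≰h+m
      z : ℕ
      z = x ∸ m
      z+m≡x : z + m ≡ x
      z+m≡x = m∸n+n≡m (≤-trans (m≤n+m m h) (<⇒≤ h+m<x))
      h<z : h < z
      h<z = +-cancelʳ-< m h z (subst (h + m <_) (sym z+m≡x) h+m<x)
      z∉T : mem T z ≡ false
      z∉T = ¬-not λ z∈T → proj₂ (proj₂ (isMinGen-sound T x x-gen))
        (m , mult≥1 T , ≤-<-trans (m≤n+m m h) h+m<x , m∈T , z∈T)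
      z-special : IsSpecialGap T z
      z-special = large-gap-special T z z∉T (<⇒≤ (<-trans m<h h<z))
        (≤-trans conductor≤h+m (subst (h + m ≤_) (sym z+m≡x) (<⇒≤ h+m<x)))
      z≢F : z ≢ F
      z≢F z≡F = x≢F+m (trans (sym z+m≡x) (cong (_+ m) z≡F))

    minGen-T⇒minGen-S : ∀ x → isMinGen T x ≡ true → x ≢ m → x ≢ F + m → isMinGen S x ≡ true
    minGen-T⇒minGen-S x x-gen x≢m x≢F+m with isMinGen-sound T x x-gen
    ... | x∈T , x≥1 , indecomposable-T =
      isMinGen-complete S x (trans (mem-S≡mem-T x (∈T⇒≢h x x∈T) x≢m) x∈T) x≥1 indecomposable-S
      where
      x≢h+S : ∀ z → 1 ≤ z → z ∈ₛ S → x ≢ h + z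
      x≢h+S z z≥1 z∈S x≡h+z = <⇒≱ (subst (h + m <_) (sym x≡h+z) (+-monoʳ-< h (∈S⇒>m z z≥1 z∈S)))
                                   (minGen≤h+m x x-gen x≢F+m)
      indecomposable-S : ¬ Decomposable S x
      indecomposable-S (y , y≥1 , y<x , y∈S , x∸y∈S) with y ≟ h | x ∸ y ≟ h
      ... | yes refl | _ = x≢h+S (x ∸ y) (m<n⇒0<n∸m y<x) x∸y∈S (sym (m+[n∸m]≡n (<⇒≤ y<x)))
      ... | no _ | yes x∸y≡h =
        x≢h+S y y≥1 y∈S (trans (sym (m∸n+n≡m (<⇒≤ y<x))) (cong (_+ y) x∸y≡h))
      ... | no y≢h | no x∸y≢h =
        indecomposable-T (y , y≥1 , y<x , ∈S⇒∈T y y∈S y≢h , ∈S⇒∈T (x ∸ y) x∸y∈S x∸y≢h)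

    embdim-A-≥ : embdim T ≤ embdim S
    embdim-A-≥ = begin
      embdim T                                    ≡⟨ embdim-padded T bound-T≥1 (bound S + mult S) ⟨
      count (isMinGen T) K                        ≤⟨ count-mono K covered ⟩
      count (λ x → (old x ∨ (x ≡ᵇ m)) ∨ (x ≡ᵇ F + m)) K
                                                  ≤⟨ count-∨-≡ᵇ (λ x → old x ∨ (x ≡ᵇ m)) (F + m) K ⟩
      suc (count (λ x → old x ∨ (x ≡ᵇ m)) K)     ≤⟨ s≤s (count-∨-≡ᵇ old m K) ⟩
      suc (suc (count old K))
        ≡⟨ cong suc (count-remove new (m + m) K m+m-new (inK (m + m) m+m-minGen)) ⟨
      suc (count new K)                           ≡⟨ count-remove (isMinGen S) h K h-minGen (inK h h-minGen) ⟨
      count (isMinGen S) K                        ≡⟨ cong (count (isMinGen S)) (+-comm (bound S + mult S) _) ⟩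
      count (isMinGen S) (bound T + mult T + (bound S + mult S))
                                                  ≡⟨ embdim-padded S bound-S≥1 (bound T + mult T) ⟩
      embdim S                                    ∎
      where
      open ≤-Reasoning
      K : ℕ
      K = (bound S + mult S) + (bound T + mult T)
      new old : ℕ → Bool
      new x = isMinGen S x ∧ not (x ≡ᵇ h)
      old x = new x ∧ not (x ≡ᵇ m + m)
      inK : ∀ x → isMinGen S x ≡ true → x < K
      inK x x-gen = <-≤-trans (isMinGen⇒< S bound-S≥1 x x-gen) (m≤m+n _ _)
      m+m-new : new (m + m) ≡ true
      m+m-new = ∧-intro m+m-minGen (cong not (≢⇒≡ᵇ-false (m + m) h (∈T⇒≢h (m + m) m+m∈T)))
      covered : ∀ x → isMinGen T x ≡ true → ((old x ∨ (x ≡ᵇ m)) ∨ (x ≡ᵇ F + m)) ≡ true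
      covered x x-gen with x ≟ m | x ≟ F + m
      ... | yes refl | _        = ∨-introˡ (∨-introʳ {old x} (≡ᵇ-refl x))
      ... | no _     | yes refl = ∨-introʳ {old x ∨ (x ≡ᵇ m)} (≡ᵇ-refl x)
      ... | no x≢m   | no x≢F+m = ∨-introˡ (∨-introˡ (∧-intro
        (∧-intro (minGen-T⇒minGen-S x x-gen x≢m x≢F+m)
                 (cong not (≢⇒≡ᵇ-false x h (∈T⇒≢h x x∈T))))
        (cong not (≢⇒≡ᵇ-false x (m + m) x≢m+m))))
        where
        x∈T : x ∈ₛ T
        x∈T = proj₁ (isMinGen-sound T x x-gen)
        x≢m+m : x ≢ m + m
        x≢m+m refl = proj₂ (proj₂ (isMinGen-sound T x x-gen)) m+m-decomposable

UpperIntervalIn : CofiniteSet → Set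
UpperIntervalIn S = ∀ x → suc (frob S) ≤ x + mult S → x < frob S → x ∈ₛ S

gap-or-UpperIntervalIn : ∀ S
  → Σ ℕ (λ y → y < frob S × mem S y ≡ false × suc (frob S) ≤ y + mult S) ⊎ UpperIntervalIn S
gap-or-UpperIntervalIn S
  with anyUpTo? (λ y → (mem S y ≟ᴮ false) ×-dec (suc (frob S) ≤? y + mult S)) (frob S)
... | yes gap = inj₁ gap
... | no ¬gap = inj₂ λ x F<x+m x<F → ¬-not λ x∉S → ¬gap (x , x<F , x∉S , F<x+m)

-- F − m(T) lies in the upper interval of A(T), yet adding m(T) to it gives the gap F.
A-not-UpperIntervalIn : ∀ {T S} → IsNumericalSemigroup T → ¬ IsSpecial T → IsA T S
  → ¬ UpperIntervalIn S
A-not-UpperIntervalIn {T} {S} T-nsg T-nonspecial S≡A interval =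
  true≢false (trans (sym F∈T) F∉T)
  where
  open A-map {T} {S} T-nsg T-nonspecial S≡A
  z : ℕ
  z = F ∸ m
  z+m≡F : z + m ≡ F
  z+m≡F = m∸n+n≡m (<⇒≤ m<F)
  F<z+mult-S : suc (frob S) ≤ z + mult S
  F<z+mult-S = subst (λ a → suc a ≤ z + mult S) (sym frob-A)
    (subst (_≤ z + mult S) (trans (+-suc z m) (cong suc z+m≡F)) (+-monoʳ-≤ z mult-A))
  z<F : z < frob S
  z<F = subst (z <_) (sym frob-A) (∸-monoʳ-< {o = 0} (mult≥1 T) (<⇒≤ m<F))
  F∈T : F ∈ₛ T
  F∈T = subst (_∈ₛ T) z+m≡F (∈S⇒+m∈T z (interval z F<z+mult-S z<F))

module _ (g n : ℕ)
  (leaf-Wilf : ∀ S → IsLeaf g n S → Wilf S)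
  (leaf-A-Wilf : ∀ S → IsLeaf g n S → ¬ IsSpecial S → UpperIntervalIn S → ∀ T → IsA S T → Wilf T)
  where

  A-Wilf : ∀ {T S} → InH g n T → ¬ IsSpecial T → IsA T S → (InH g n T → Wilf T) → Wilf S
  A-Wilf {T} {S} T∈H T-nonspecial S≡A wilf-T with gap-or-UpperIntervalIn T
  ... | inj₁ (y , y<F , y∉T , F<y+m) =
    Wilf-transfer S T conductor-A nS-A (embdim-A-≥ y∉T y<F F<y+m) (wilf-T T∈H)
    where open A-map {T} {S} (proj₁ T∈H) T-nonspecial S≡A
  ... | inj₂ interval = leaf-A-Wilf T (T∈H , T-leaf) T-nonspecial interval S S≡A
    where
    T-leaf : ¬ Σ CofiniteSet (λ U → Child g n U T)
    T-leaf (U , U∈H , U-nonspecial , T≡A) =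
      A-not-UpperIntervalIn {U} {T} (proj₁ U∈H) U-nonspecial T≡A interval

  Wilf-H : ∀ S → InH g n S → Wilf S
  Wilf-H = All.wfRec (On.wellFounded mult <-wellFounded) 0ℓ (λ S → InH g n S → Wilf S) step
    where
    step : ∀ S → (∀ {T} → mult T < mult S → InH g n T → Wilf T) → InH g n S → Wilf S
    step S ih S∈H with conductor S ≤? embdim S * nS S
    ... | yes wilf = wilf
    ... | no ¬wilf = contradiction (leaf-Wilf S (S∈H , no-child)) ¬wilf
      where
      no-child : ¬ Σ CofiniteSet (λ T → Child g n T S)
      no-child (T , T∈H , T-nonspecial , S≡A) = ¬wilf (A-Wilf {T} {S} T∈H T-nonspecial S≡A
        (ih {T} (A-map.mult-A {T} {S} (proj₁ T∈H) T-nonspecial S≡A)))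

theorem5p9 : (g n : ℕ) → 3 < g → 2 ≤ n → n ≤ g ∸ 2
    → (∀ S → IsLeaf g n S → Wilf S)
    → (∀ S → IsLeaf g n S → ¬ IsSpecial S
    → (∀ x → suc (frob S) ≤ x + mult S → x < frob S → x ∈ₛ S)
    → ∀ T → IsA S T → Wilf T)
    → ∀ S → InH g n S → Wilf S
theorem5p9 g n _ _ _ = Wilf-H g n
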